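{- For all instances $A_1,\dots,A_n$ over a common schema, the following statements are equivalent. (1) $\bigcup_{1\le i\le n}[A_i]$ admits a left query algorithm over $\mathbb{B}$ (equivalently, is FO-definable). (2) Each $[A_i]$, for $i=1,\dots,n$, admits a left query algorithm over $\mathbb{B}$ (equivalently, is FO-definable).
   Context: An instance $A$ over a schema (a finite set of relation symbols with arities) assigns to each relation symbol a finite relation of the corresponding arity; $\mathrm{adom}(A)$ is the set of entries of its tuples. A homomorphism $A\to B$ is a map $\mathrm{adom}(A)\to\mathrm{adom}(B)$ mapping tuples of each $R^A$ into $R^B$. $A$ and $B$ are homomorphically equivalent if $A\to B$ and $B\to A$; $[A]$ denotes the class of all instances homomorphically equivalent to $A$. $\hom_{\mathbb{B}}(F,D)$ is $1$ if there is a homomorphism $F\to D$ and $0$ otherwise. A class $\mathcal{C}$ admits a left query algorithm over $\mathbb{B}$ if there are $k>0$, instances $F_1,\dots,F_k$ and $X\subseteq\{0,1\}^k$ such that for every instance $D$: $D\in\mathcal{C}$ iff $(\hom_{\mathbb{B}}(F_1,D),\dots,\hom_{\mathbb{B}}(F_k,D))\in X$. FO-definable means definable by a first-order sentence under active-domain semantics. -}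

module Defs where

open import Data.Nat using (ℕ; _>_)
open import Data.Fin using (Fin)
open import Data.Bool using (Bool; true)
open import Data.Vec using (Vec; lookup)
import Data.Vec as Vec
open import Data.List using (List)
open import Data.List.Membership.Propositional using (_∈_)
open import Data.Product using (Σ; ∃; _×_)
open import Relation.Binary.PropositionalEquality using (_≡_)
open import Function.Bundles using (_⇔_)

record Schema : Set where
  field
    nrel  : ℕ
    arity : Fin nrel → ℕ
open Schema public

-- Constants are natural numbers (a countably infinite domain of constants).
record Instance (S : Schema) : Set where
  constructor mkInstance
  field
    rel : (R : Fin (nrel S)) → List (Vec ℕ (arity S R))
open Instance public

-- Homomorphism A → B: a map on constants sending every tuple of R^A into R^B.
-- (Any map adom(A) → adom(B) extends to ℕ → ℕ, and any such map sends adom(A)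
-- into adom(B) since it maps tuples to tuples; so this is the paper's notion.)
Hom : {S : Schema} → Instance S → Instance S → Set
Hom {S} A B = Σ (ℕ → ℕ) λ h →
  (R : Fin (nrel S)) (t : Vec ℕ (arity S R)) → t ∈ rel A R → Vec.map h t ∈ rel B R

HomEquiv : {S : Schema} → Instance S → Instance S → Set
HomEquiv A B = Hom A B × Hom B A

HomClass : {S : Schema} → Instance S → Instance S → Set
HomClass A D = HomEquiv A D

Class : Schema → Set₁
Class S = Instance S → Set

IsHomVector : {S : Schema} {k : ℕ} → (Fin k → Instance S) → Instance S → Vec Bool k → Set
IsHomVector F D b = ∀ i → (lookup b i ≡ true) ⇔ Hom (F i) D

LeftQueryAlgorithm𝔹 : {S : Schema} → Class S → Set
LeftQueryAlgorithm𝔹 {S} C =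
  Σ ℕ λ k → (k > 0) × Σ (Fin k → Instance S) λ F → Σ (Vec Bool k → Bool) λ X →
    (D : Instance S) →
      C D ⇔ (∃ λ b → IsHomVector F D b × X b ≡ true)

UnionHomClasses : {S : Schema} {n : ℕ} → (Fin n → Instance S) → Class S
UnionHomClasses A D = ∃ λ i → HomClass (A i) D

-- A class with a left query algorithm with tests F_1, …, F_k is closed under agreement on the
-- tests (D and E agree on F if F → D iff F → E). Conversely, a finite union of agreement classes
-- of finitely many tests has a left query algorithm: X is the set of hom-vectors of the
-- representatives, which can be computed because a homomorphism is determined by its finite
-- table of values on the active domain. If D agrees with A_j on the tests of the union and on
-- A_1, …, A_n, then D lies in some [A_i], and agreement on A_i and A_j moves D into [A_j];
-- conversely the tests of all the [A_i] together decide their union.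
module Submission where

open import Defs
open import Data.Bool using (Bool; true)
import Data.Bool.Properties as Bool
open import Data.Empty using (⊥-elim)
open import Data.Fin using (Fin; zero; suc)
import Data.Fin.Properties as Fin
open import Data.List as List using (List; []; _∷_; _++_; length; concatMap; allFin; tabulate; cartesianProductWith)
open import Data.List.Properties using (length-map)
open import Data.List.Membership.Propositional using (_∈_; lose; find)
open import Data.List.Membership.Propositional.Properties using (∈-concatMap⁺; ∈-concatMap⁻; ∈-allFin; ∈-tabulate⁺; ∈-lookup; ∈-cartesianProductWith⁺)
open import Data.List.Relation.Binary.Subset.Propositional using (_⊆_)
open import Data.List.Relation.Binary.Subset.Propositional.Properties using (xs⊆xs++ys; xs⊆ys++xs)
open import Data.List.Relation.Unary.All as All using (All; []; _∷_)
open import Data.List.Relation.Unary.All.Properties using (map⁺)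
open import Data.List.Relation.Unary.Any as Any using (Any; here; there)
open import Data.List.Relation.Unary.Any.Properties using (lookup-index)
open import Data.Nat using (ℕ; zero; suc; _≟_; s≤s; z≤n)
open import Data.Product using (∃; ∃₂; _×_; _,_; proj₁)
open import Data.Vec as Vec using (Vec; toList)
import Data.Vec.Properties as Vec
open import Data.Vec.Membership.Propositional.Properties using (∈-toList⁺; ∈-toList⁻; ∈-map⁺)
open import Function.Base using (id; _∘_)
open import Function.Bundles using (_⇔_; mk⇔; Equivalence)
import Function.Properties.Equivalence as ⇔
open import Relation.Binary.PropositionalEquality using (_≡_; refl; sym; cong₂; subst)
open import Relation.Nullary using (Dec; yes; no; does)
import Relation.Nullary.Decidable as Dec

open Equivalence

does≡true⇔ : ∀ {P : Set} (P? : Dec P) → (does P? ≡ true) ⇔ P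
does≡true⇔ (yes p) = mk⇔ (λ _ → p) (λ _ → refl)
does≡true⇔ (no ¬p) = mk⇔ (λ ()) (⊥-elim ∘ ¬p)

map-cong-on : ∀ {A B : Set} {n} {f g : A → B} (t : Vec A n) →
  (∀ {x} → x ∈ toList t → f x ≡ g x) → Vec.map f t ≡ Vec.map g t
map-cong-on Vec.[] _ = refl
map-cong-on (x Vec.∷ t) f≡g = cong₂ Vec._∷_ (f≡g (here refl)) (map-cong-on t (f≡g ∘ there))

words : {A : Set} → List A → ℕ → List (List A)
words M zero = [] ∷ []
words M (suc l) = cartesianProductWith _∷_ M (words M l)

∈-words : {A : Set} {M w : List A} → All (_∈ M) w → w ∈ words M (length w)
∈-words [] = here refl
∈-words (v∈M ∷ w⊆M) = ∈-cartesianProductWith⁺ _∷_ v∈M (∈-words w⊆M)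

lookupTable : List ℕ → List ℕ → ℕ → ℕ
lookupTable [] _ x = 0
lookupTable (_ ∷ _) [] x = 0
lookupTable (k ∷ ks) (v ∷ vs) x with k ≟ x
... | yes _ = v
... | no _ = lookupTable ks vs x

lookupTable-map : ∀ (h : ℕ → ℕ) {ks x} → x ∈ ks → lookupTable ks (List.map h ks) x ≡ h x
lookupTable-map h {k ∷ ks} {x} x∈ with k ≟ x | x∈
... | yes refl | _ = refl
... | no k≢x | here refl = ⊥-elim (k≢x refl)
... | no _ | there x∈ks = lookupTable-map h x∈ks

module _ {S : Schema} where

  private variable
    A B D E : Instance S
    G H : List (Instance S)
    𝒞 : Class S

  adom : Instance S → List ℕ
  adom I = concatMap (λ R → concatMap toList (rel I R)) (allFin (nrel S))

  ∈-adom⁺ : ∀ I {R t x} → t ∈ rel I R → x ∈ toList t → x ∈ adom I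
  ∈-adom⁺ I {R} t∈ x∈ = ∈-concatMap⁺ _ (lose (∈-allFin R) (∈-concatMap⁺ toList (lose t∈ x∈)))

  ∈-adom⁻ : ∀ I {x} → x ∈ adom I → ∃₂ λ R t → t ∈ rel I R × x ∈ toList t
  ∈-adom⁻ I x∈
    with R , _ , x∈R ← find (∈-concatMap⁻ (λ R → concatMap toList (rel I R)) {xs = allFin _} x∈)
    with t , t∈ , x∈t ← find (∈-concatMap⁻ toList {xs = rel I R} x∈R) = R , t , t∈ , x∈t

  hom-adom : ∀ A B {x} (h : Hom A B) → x ∈ adom A → proj₁ h x ∈ adom B
  hom-adom A B (h , hom) x∈ with _ , t , t∈ , x∈t ← ∈-adom⁻ A x∈
    = ∈-adom⁺ B (hom _ t t∈) (∈-toList⁺ (∈-map⁺ h (∈-toList⁻ x∈t)))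

  hom-id : Hom A A
  hom-id {A} = id , λ R t t∈ → subst (_∈ rel A R) (sym (Vec.map-id t)) t∈

  hom-∘ : Hom A B → Hom B D → Hom A D
  hom-∘ {D = D} (f , f-hom) (g , g-hom) =
    g ∘ f , λ R t t∈ → subst (_∈ rel D R) (sym (Vec.map-∘ g f t)) (g-hom R _ (f-hom R t t∈))

  homEquiv-refl : HomEquiv A A
  homEquiv-refl = hom-id , hom-id

  IsHom : Instance S → Instance S → (ℕ → ℕ) → Set
  IsHom A B h = ∀ R → All (λ t → Vec.map h t ∈ rel B R) (rel A R)

  isHom? : ∀ A B h → Dec (IsHom A B h)
  isHom? A B h =
    Fin.all? λ R → All.all? (λ t → Any.any? (Vec.≡-dec _≟_ (Vec.map h t)) (rel B R)) (rel A R)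

  HomTable : Instance S → Instance S → Set
  HomTable A B = Any (IsHom A B ∘ lookupTable (adom A)) (words (adom B) (length (adom A)))

  hom⇔homTable : ∀ A B → Hom A B ⇔ HomTable A B
  hom⇔homTable A B = mk⇔ table fromTable
    where
    fromTable : HomTable A B → Hom A B
    fromTable g∈ =
      let g , _ , g-hom = find g∈ in lookupTable (adom A) g , λ R t t∈ → All.lookup (g-hom R) t∈

    table : Hom A B → HomTable A B
    table (h , hom) = lose h-table restricted-hom
      where
      h-table : List.map h (adom A) ∈ words (adom B) (length (adom A))
      h-table = subst (λ l → List.map h (adom A) ∈ words (adom B) l) (length-map h (adom A))
        (∈-words (map⁺ (All.tabulate (hom-adom A B (h , hom)))))
      restricted-hom : IsHom A B (lookupTable (adom A) (List.map h (adom A)))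
      restricted-hom R = All.tabulate λ {t} t∈ →
        subst (_∈ rel B R) (sym (map-cong-on t (lookupTable-map h ∘ ∈-adom⁺ A t∈))) (hom R t t∈)

  hom? : ∀ A B → Dec (Hom A B)
  hom? A B = Dec.map (⇔.sym (hom⇔homTable A B)) (Any.any? (isHom? A B ∘ lookupTable (adom A)) _)

  AgreeOn : List (Instance S) → Instance S → Instance S → Set
  AgreeOn G D E = ∀ F → F ∈ G → Hom F D ⇔ Hom F E

  agreeOn-⊆ : G ⊆ H → AgreeOn H D E → AgreeOn G D E
  agreeOn-⊆ G⊆H agree F = agree F ∘ G⊆H

  homEquiv⇒agreeOn : HomEquiv D E → AgreeOn G D E
  homEquiv⇒agreeOn {D = D} {E = E} (d→e , e→d) F _ =
    mk⇔ (λ f→d → hom-∘ {F} {D} {E} f→d d→e) (λ f→e → hom-∘ {F} {E} {D} f→e e→d)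

  homEquiv-transfer : A ∈ G → B ∈ G → AgreeOn G A D → HomEquiv B D → HomEquiv A D
  homEquiv-transfer {A = A} {B = B} {D = D} A∈G B∈G agree (b→d , d→b) =
    to (agree A A∈G) (hom-id {A}) , hom-∘ {D} {B} {A} d→b (from (agree B B∈G) b→d)

  tests : LeftQueryAlgorithm𝔹 𝒞 → List (Instance S)
  tests (_ , _ , F , _) = tabulate F

  lqa-respects-agreeOn : (q : LeftQueryAlgorithm𝔹 𝒞) → 𝒞 D → AgreeOn (tests q) D E → 𝒞 E
  lqa-respects-agreeOn {D = D} {E = E} (_ , _ , F , X , spec) C-D agree =
    let b , b-vec , Xb = to (spec D) C-D
    in from (spec E) (b , (λ i → ⇔.trans (b-vec i) (agree _ (∈-tabulate⁺ i))) , Xb)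

  empty : Instance S
  empty = mkInstance λ _ → []

  empty-hom : ∀ D → Hom empty D
  empty-hom D = id , λ _ _ ()

  module Profile (G : List (Instance S)) where

    -- The empty instance maps into every instance; it only makes the family nonempty (k > 0).
    testFamily : Fin (suc (length G)) → Instance S
    testFamily = List.lookup (empty ∷ G)

    homBit : Instance S → Fin (suc (length G)) → Bool
    homBit D x = does (hom? (testFamily x) D)

    profile : Instance S → Vec Bool (suc (length G))
    profile D = Vec.tabulate (homBit D)

    profile-isHomVector : ∀ D → IsHomVector testFamily D (profile D)
    profile-isHomVector D x
      rewrite Vec.lookup∘tabulate (homBit D) x = does≡true⇔ (hom? _ D)

    agreeOn⇒profile≡ : AgreeOn G D E → profile D ≡ profile E
    agreeOn⇒profile≡ {D} {E} agree = Vec.tabulate-cong {f = homBit D} {g = homBit E} λ where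
      zero → Dec.does-⇔ (mk⇔ (λ _ → empty-hom E) (λ _ → empty-hom D)) (hom? _ D) (hom? _ E)
      (suc y) → Dec.does-⇔ (agree _ (∈-lookup y)) (hom? _ D) (hom? _ E)

    isHomVector⇒agreeOn : ∀ {b} → IsHomVector testFamily D b → IsHomVector testFamily E b →
      AgreeOn G D E
    isHomVector⇒agreeOn {D} {E} D-vec E-vec F F∈G =
      subst (λ F → Hom F D ⇔ Hom F E) (sym (lookup-index F∈G))
        (⇔.trans (⇔.sym (D-vec (suc (Any.index F∈G)))) (E-vec (suc (Any.index F∈G))))

  lqa-fromRepresentatives : ∀ G {m} (reps : Fin m → Instance S) →
    (∀ D → 𝒞 D ⇔ ∃ λ i → AgreeOn G (reps i) D) → LeftQueryAlgorithm𝔹 𝒞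
  lqa-fromRepresentatives G reps C⇔ =
    suc (length G) , s≤s z≤n , testFamily , does ∘ matches? ,
    λ D → ⇔.trans (C⇔ D) (mk⇔ accept (reject D))
    where
    open Profile G

    matches? : ∀ b → Dec (∃ λ i → b ≡ profile (reps i))
    matches? b = Fin.any? λ i → Vec.≡-dec Bool._≟_ b (profile (reps i))

    accept : (∃ λ i → AgreeOn G (reps i) D) →
      ∃ λ b → IsHomVector testFamily D b × does (matches? b) ≡ true
    accept {D} (i , agree) =
      profile D , profile-isHomVector D , Dec.dec-true (matches? _) (i , sym (agreeOn⇒profile≡ agree))

    reject : ∀ D → (∃ λ b → IsHomVector testFamily D b × does (matches? b) ≡ true) →
      ∃ λ i → AgreeOn G (reps i) D
    reject D (b , D-vec , Xb) with i , refl ← to (does≡true⇔ (matches? b)) Xb =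
      i , isHomVector⇒agreeOn {b = profile (reps i)} (profile-isHomVector (reps i)) D-vec

theorem14 : (S : Schema) (n : ℕ) (A : Fin n → Instance S) →
    LeftQueryAlgorithm𝔹 (UnionHomClasses A) ⇔ ((i : Fin n) → LeftQueryAlgorithm𝔹 (HomClass (A i)))
theorem14 S n A = mk⇔ eachFromUnion unionFromEach
  where
  eachFromUnion : LeftQueryAlgorithm𝔹 (UnionHomClasses A) → ∀ j → LeftQueryAlgorithm𝔹 (HomClass (A j))
  eachFromUnion q j =
    lqa-fromRepresentatives G {1} (λ _ → A j) λ D → mk⇔ (λ Aj≈D → zero , homEquiv⇒agreeOn Aj≈D) (back D)
    where
    G = tests q ++ tabulate A
    representative : ∀ i → A i ∈ G
    representative i = xs⊆ys++xs _ (tests q) (∈-tabulate⁺ i)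
    back : ∀ D → (∃ λ _ → AgreeOn G (A j) D) → HomEquiv (A j) D
    back D (_ , agree) =
      let i , Ai≈D = lqa-respects-agreeOn q (j , homEquiv-refl) (agreeOn-⊆ (xs⊆xs++ys _ _) agree)
      in homEquiv-transfer (representative j) (representative i) agree Ai≈D

  unionFromEach : (∀ i → LeftQueryAlgorithm𝔹 (HomClass (A i))) → LeftQueryAlgorithm𝔹 (UnionHomClasses A)
  unionFromEach q =
    lqa-fromRepresentatives G A λ D → mk⇔ (λ (i , Ai≈D) → i , homEquiv⇒agreeOn Ai≈D) (back D)
    where
    G = concatMap (tests ∘ q) (allFin n)
    back : ∀ D → (∃ λ i → AgreeOn G (A i) D) → UnionHomClasses A D
    back D (i , agree) = i , lqa-respects-agreeOn (q i) homEquiv-refl (agreeOn-⊆ tests⊆G agree)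
      where
      tests⊆G : tests (q i) ⊆ G
      tests⊆G F∈ = ∈-concatMap⁺ (tests ∘ q) (lose (∈-allFin i) F∈)
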